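{- Let $X\subseteq B^n$ be a nonempty well-behaved sequence set. Then $p(X)\neq\emptyset$ and $s(X) \ge H_{1+\max}\,\{\, s((X/i)^\circ) \mid i \in p(X) \,\}_\#$ (a multiset with one entry for each $i\in p(X)$).
   Context: $B=\{0,1\}$, $[n]=\{1,\dots,n\}$. A comparator $[i,j]$ ($i\ne j\in[n]$) maps $x\in B^n$ to the sequence obtained by replacing $x_i$ by $\min(x_i,x_j)$ and $x_j$ by $\max(x_i,x_j)$; an exchange $(i,j)$ swaps entries $i$ and $j$. A comparator network is a finite sequence of comparators and exchanges applied left to right; its size is its number of comparators. For $X\subseteq B^n$, $s(X)$ is the minimal size of a comparator network whose output on every $x\in X$ is sorted (nondecreasing). For $x\in B^n$, $x/i\in B^{n-1}$ is $x$ with entry $i$ deleted; $X/i=\{x/i\mid x\in X,\ x_i=1\}$. The one-hot sequence $e^{(i,n)}$ has a $1$ exactly at position $i$; $p(X)=\{i\in[n]\mid e^{(i,n)}\in X\}$ is the set of prunable channels. Threshold sets: for a permutation $y$ of $(1,\dots,n)$, $T(y)=\{([y_1\ge k],\dots,[y_n\ge k]) \mid 1\le k\le n+1\}\subseteq B^n$, where $[P]$ is $1$ if $P$ holds and $0$ otherwise. $X\subseteq B^n$ is well-behaved if it is a union of threshold sets. For any $Y\subseteq B^m$, its well-behaved interior $Y^\circ$ is the union of all threshold sets contained in $Y$. For a nonempty finite multiset $L$ of nonnegative integers, $H_{1+\max}L$ is computed by repeatedly removing two smallest elements $a,b$ and inserting $1+\max(a,b)$ until one element remains, which is returned. -}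

module Defs where

open import Data.Bool using (Bool; true; false; _∧_; _∨_)
open import Data.Nat using (ℕ; zero; suc; _≤_; _≤ᵇ_; _⊔_)
open import Data.Fin using (Fin; toℕ) renaming (_≤_ to _≤ᶠ_)
open import Data.Fin.Properties using () renaming (_≟_ to _≟ᶠ_)
open import Data.Fin.Permutation using (Permutation′; _⟨$⟩ʳ_)
open import Data.Vec using (Vec; lookup; tabulate; _[_]≔_; removeAt)
open import Data.List using (List; []; _∷_; length; map)
open import Data.List.Relation.Unary.Any using (Any)
open import Data.Product using (Σ; ∃; _×_; _,_)
open import Relation.Nullary using (¬_; does)
open import Relation.Binary.PropositionalEquality using (_≡_; _≢_)
open import Function.Bundles using (_⇔_)

B^ : ℕ → Set
B^ n = Vec Bool n

BSet : ℕ → Set₁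
BSet n = B^ n → Set

data Op (n : ℕ) : Set where
  cmp  : (i j : Fin n) → i ≢ j → Op n
  exch : (i j : Fin n) → Op n

Network : ℕ → Set
Network n = List (Op n)

applyOp : ∀ {n} → Op n → B^ n → B^ n
applyOp (cmp i j _) x = (x [ i ]≔ (lookup x i ∧ lookup x j)) [ j ]≔ (lookup x i ∨ lookup x j)
applyOp (exch i j)  x = (x [ i ]≔ lookup x j) [ j ]≔ lookup x i

apply : ∀ {n} → Network n → B^ n → B^ n
apply []       x = x
apply (o ∷ os) x = apply os (applyOp o x)

size : ∀ {n} → Network n → ℕ
size []              = 0
size (cmp _ _ _ ∷ os) = suc (size os)
size (exch _ _ ∷ os)  = size os

Sorted : ∀ {n} → B^ n → Set
Sorted {n} x = ∀ (i j : Fin n) → i ≤ᶠ j → lookup x i ≡ true → lookup x j ≡ true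

Sorts : ∀ {n} → Network n → BSet n → Set
Sorts N X = ∀ x → X x → Sorted (apply N x)

IsMinSize : ∀ {n} → BSet n → ℕ → Set
IsMinSize X m = (Σ _ λ N → Sorts N X × size N ≡ m) × (∀ N → Sorts N X → m ≤ size N)

del : ∀ {n} → BSet (suc n) → Fin (suc n) → BSet n
del X i y = ∃ λ x → X x × lookup x i ≡ true × removeAt x i ≡ y

oneHot : ∀ {n} → Fin n → B^ n
oneHot i = tabulate (λ j → does (j ≟ᶠ i))

Prunable : ∀ {n} → BSet n → Fin n → Set
Prunable X i = X (oneHot i)

-- threshold set T(y); the permutation y of (1..n) is π with y_j = 1 + toℕ (π j)
InT : ∀ {n} → Permutation′ n → B^ n → Set
InT {n} π x = ∃ λ k → 1 ≤ k × k ≤ suc n × x ≡ tabulate (λ j → k ≤ᵇ suc (toℕ (π ⟨$⟩ʳ j)))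

WellBehaved : ∀ {n} → BSet n → Set
WellBehaved {n} X = ∃ λ (ps : List (Permutation′ n)) → ∀ x → X x ⇔ Any (λ π → InT π x) ps

interior : ∀ {n} → BSet n → BSet n
interior Y x = ∃ λ π → (∀ z → InT π z → Y z) × InT π x

insert : ℕ → List ℕ → List ℕ
insert a []       = a ∷ []
insert a (b ∷ bs) with a ≤ᵇ b
... | true  = a ∷ b ∷ bs
... | false = b ∷ insert a bs

isort : List ℕ → List ℕ
isort []       = []
isort (a ∷ as) = insert a (isort as)

-- operates on a sorted list; fuel bounds the number of merge steps
H-go : ℕ → List ℕ → ℕ
H-go _        []           = 0
H-go _        (a ∷ [])     = a
H-go zero     (a ∷ _ ∷ _)  = a
H-go (suc f)  (a ∷ b ∷ rs) = H-go f (insert (suc (a ⊔ b)) rs)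

-- (value on the empty multiset is irrelevant; set to 0)
H1+max : List ℕ → ℕ
H1+max L = H-go (length L) (isort L)

module Submission where

-- Let N sort X. For a prunable channel i the single 1 of e_i travels along a path through N, meeting
-- hits N i comparators, and must leave on the last channel. Deleting this path (a comparator it meets
-- acts as an exchange or as the identity) leaves a network of size size N - hits N i sorting X/i, so
-- s((X/i)°) + hits N i ≤ size N. Paths ending on the same channel merge at comparators, which gives
-- Kraft's inequality Σ_i 2^(-hits N i) ≤ 1, hence Σ_i 2^(s((X/i)°)) ≤ 2^(size N). Finally
-- Σ_a 2^a ≤ 2^h forces H_{1+max} ≤ h, since merging the two smallest entries a ≤ b into b + 1 keeps
-- the sum of powers of two at most 2^h. Nonemptiness of p(X): every threshold set contains a one-hot
-- sequence.

open import Defs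
open import Data.Nat using (ℕ; zero; suc; _+_; _*_; _∸_; _^_; _≤_; _<_; _⊔_; _≤ᵇ_; z≤n; s≤s; s≤s⁻¹)
open import Data.Fin using (Fin; zero; suc; punchIn; punchOut; fromℕ; toℕ)
open import Data.List using (List; []; _∷_; length; map)
open import Data.List.Membership.Propositional using (_∈_; find; lose)
open import Data.List.Relation.Unary.Unique.Propositional using (Unique)
open import Data.Product using (∃; _×_; _,_)
open import Function.Bundles using (_⇔_; Equivalence)

open import Data.Bool using (Bool; true; false; if_then_else_; _∨_; _∧_)
open import Data.Bool.Properties using (∨-zeroʳ; ∧-identityʳ)
open import Data.Empty using (⊥-elim)
open import Data.Fin.Properties
  using (_≟_; suc-injective; punchInᵢ≢i; punchIn-punchOut; punchOut-punchIn; punchIn-mono-≤;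
         ≤fromℕ; toℕ-fromℕ; toℕ<n; toℕ-injective)
import Data.Fin.Permutation.Components as PC
open import Data.Fin.Permutation as Perm
  using (Permutation′; _⟨$⟩ʳ_; _⟨$⟩ˡ_; _∘ₚ_; transpose; remove; lift₀; lift₀-remove;
         inverseˡ; inverseʳ; flip; punchIn-permute)
open import Data.List.Properties using (map-∘)
open import Data.List.Relation.Unary.All as All using (All; []; _∷_)
open import Data.List.Relation.Unary.All.Properties using (All¬⇒¬Any)
open import Data.List.Relation.Unary.AllPairs using (AllPairs; []; _∷_)
open import Data.List.Relation.Unary.Any using (any?)
open import Data.List.Relation.Binary.Permutation.Propositional
  using (_↭_; ↭-refl; ↭-prep; ↭-swap; ↭-trans; ↭-sym)
open import Data.List.Relation.Binary.Permutation.Propositional.Properties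
  using (map⁺; ↭-length; All-resp-↭)
open import Data.Nat.Divisibility using (_∣_; divides; ∣m∣n⇒∣m+n; n∣n)
import Data.Nat.ListAction as ListAction
open import Data.Nat.ListAction.Properties using (sum-↭)
open import Data.Nat.Properties hiding (_≟_; suc-injective)
open import Data.Vec using (_∷_; lookup; removeAt; _[_]≔_)
open import Data.Vec.Properties
  using (lookup∘update; lookup∘update′; lookup∘tabulate; tabulate-cong; removeAt-punchOut)
open import Data.Vec.Functional using (updateAt)
open import Data.Vec.Functional.Properties using (updateAt-updates; updateAt-minimal)
open import Function using (_∘_; const)
open import Relation.Binary.PropositionalEquality
open import Relation.Nullary using (Dec; yes; no; does; proof)
open import Relation.Nullary.Decidable using (dec-true; dec-false)
open import Relation.Nullary.Reflects using (ofʸ; ofⁿ; det; fromEquivalence)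
open import Algebra.Properties.CommutativeMonoid.Sum +-0-commutativeMonoid
  using (sum; sum-remove; sum-permute; sum-cong-≗; sum-replicate-zero)

-- Sums of powers of two and H_{1+max}

sum2^ : List ℕ → ℕ
sum2^ as = ListAction.sum (map (2 ^_) as)

sum2^-↭ : ∀ {as bs} → as ↭ bs → sum2^ as ≡ sum2^ bs
sum2^-↭ p = sum-↭ (map⁺ (2 ^_) p)

insert-↭ : ∀ a bs → insert a bs ↭ a ∷ bs
insert-↭ a []       = ↭-refl
insert-↭ a (b ∷ bs) with a ≤ᵇ b
... | true  = ↭-refl
... | false = ↭-trans (↭-prep b (insert-↭ a bs)) (↭-swap b a ↭-refl)

isort-↭ : ∀ as → isort as ↭ as
isort-↭ []       = ↭-refl
isort-↭ (a ∷ as) = ↭-trans (insert-↭ a (isort as)) (↭-prep a (isort-↭ as))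

insert-sorted : ∀ a {bs} → AllPairs _≤_ bs → AllPairs _≤_ (insert a bs)
insert-sorted a {[]}     []                = [] ∷ []
insert-sorted a {b ∷ bs} (b≤bs ∷ bs-sorted) with a ≤ᵇ b | ≤ᵇ-reflects-≤ a b
... | true  | ofʸ a≤b = (a≤b ∷ All.map (≤-trans a≤b) b≤bs) ∷ b≤bs ∷ bs-sorted
... | false | ofⁿ a≰b =
  All-resp-↭ (↭-sym (insert-↭ a bs)) (<⇒≤ (≰⇒> a≰b) ∷ b≤bs) ∷ insert-sorted a bs-sorted

isort-sorted : ∀ as → AllPairs _≤_ (isort as)
isort-sorted []       = []
isort-sorted (a ∷ as) = insert-sorted a (isort-sorted as)

m^n∣m^o : ∀ m {n o} → n ≤ o → m ^ n ∣ m ^ o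
m^n∣m^o m {n} {o} n≤o = divides (m ^ (o ∸ n)) (begin
  m ^ o                 ≡⟨ cong (m ^_) (m+[n∸m]≡n n≤o) ⟨
  m ^ (n + (o ∸ n))     ≡⟨ ^-distribˡ-+-* m n (o ∸ n) ⟩
  m ^ n * m ^ (o ∸ n)   ≡⟨ *-comm (m ^ n) _ ⟩
  m ^ (o ∸ n) * m ^ n   ∎)
  where open ≡-Reasoning

2^∣sum2^ : ∀ {b rs} → All (b ≤_) rs → 2 ^ b ∣ sum2^ rs
2^∣sum2^ []             = divides 0 refl
2^∣sum2^ (b≤r ∷ b≤rs) = ∣m∣n⇒∣m+n (m^n∣m^o 2 b≤r) (2^∣sum2^ b≤rs)

d∣m∧d∣n∧m<n⇒d+m≤n : ∀ {d m n} → d ∣ m → d ∣ n → m < n → d + m ≤ n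
d∣m∧d∣n∧m<n⇒d+m≤n {d} (divides p refl) (divides q refl) pd<qd =
  *-monoˡ-≤ d (*-cancelʳ-< d p q pd<qd)

2^m≤2^n⇒m≤n : ∀ m n → 2 ^ m ≤ 2 ^ n → m ≤ n
2^m≤2^n⇒m≤n m n le = ≮⇒≥ (λ n<m → <⇒≱ (^-monoʳ-< 2 (s≤s (s≤s z≤n)) n<m) le)

-- 2 ^ b divides 2 ^ h and 2 ^ b + sum2^ rs (all of rs is ≥ b), and 2 ^ a > 0 makes the latter smaller,
-- so the gap is at least 2 ^ b.
merge-two-smallest : ∀ {a b rs h} → a ≤ b → All (b ≤_) rs →
                     sum2^ (a ∷ b ∷ rs) ≤ 2 ^ h → sum2^ (suc (a ⊔ b) ∷ rs) ≤ 2 ^ h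
merge-two-smallest {a} {b} {rs} {h} a≤b b≤rs fits rewrite m≤n⇒m⊔n≡n a≤b = begin
  2 ^ suc b + sum2^ rs           ≡⟨ cong (_+ sum2^ rs) (cong (2 ^ b +_) (+-identityʳ (2 ^ b))) ⟩
  2 ^ b + 2 ^ b + sum2^ rs       ≡⟨ +-assoc (2 ^ b) (2 ^ b) (sum2^ rs) ⟩
  2 ^ b + (2 ^ b + sum2^ rs)     ≤⟨ d∣m∧d∣n∧m<n⇒d+m≤n 2^b∣rest 2^b∣2^h rest<2^h ⟩
  2 ^ h                          ∎
  where
  open ≤-Reasoning
  rest = 2 ^ b + sum2^ rs
  rest<2^h : rest < 2 ^ h
  rest<2^h = <-≤-trans (m<n+m rest (m^n>0 2 a)) fits
  2^b∣rest : 2 ^ b ∣ rest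
  2^b∣rest = ∣m∣n⇒∣m+n n∣n (2^∣sum2^ b≤rs)
  2^b∣2^h : 2 ^ b ∣ 2 ^ h
  2^b∣2^h = m^n∣m^o 2 (2^m≤2^n⇒m≤n b h (≤-trans (m≤m+n (2 ^ b) (sum2^ rs)) (<⇒≤ rest<2^h)))

H-go-≤ : ∀ f {ms} h → AllPairs _≤_ ms → length ms ≤ suc f → sum2^ ms ≤ 2 ^ h → H-go f ms ≤ h
H-go-≤ f       {[]}         h _ _ _ = z≤n
H-go-≤ f       {a ∷ []}     h _ _ fits = 2^m≤2^n⇒m≤n a h (≤-trans (m≤m+n (2 ^ a) 0) fits)
H-go-≤ zero    {a ∷ b ∷ rs} h _ (s≤s ()) _
H-go-≤ (suc f) {a ∷ b ∷ rs} h ((a≤b ∷ _) ∷ b≤rs ∷ rs-sorted) (s≤s len) fits =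
  H-go-≤ f h (insert-sorted c rs-sorted)
    (subst (_≤ suc f) (sym (↭-length (insert-↭ c rs))) len)
    (subst (_≤ 2 ^ h) (sym (sum2^-↭ (insert-↭ c rs))) (merge-two-smallest {h = h} a≤b b≤rs fits))
  where c = suc (a ⊔ b)

H1+max-≤ : ∀ as h → sum2^ as ≤ 2 ^ h → H1+max as ≤ h
H1+max-≤ as h fits = H-go-≤ (length as) h (isort-sorted as)
  (subst (_≤ suc (length as)) (sym (↭-length (isort-↭ as))) (n≤1+n (length as)))
  (subst (_≤ 2 ^ h) (sym (sum2^-↭ (isort-↭ as))) fits)

sum-updateAt : ∀ {m} (g : Fin m → ℕ) a f → sum (updateAt g a f) + g a ≡ f (g a) + sum g
sum-updateAt {suc m} g a f = begin
  sum (updateAt g a f) + g a                              ≡⟨ cong (_+ g a) (sum-remove (updateAt g a f)) ⟩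
  updateAt g a f a + sum (updateAt g a f ∘ punchIn a) + g a
    ≡⟨ cong₂ (λ x y → x + y + g a) (updateAt-updates a g) (sum-cong-≗ unchanged) ⟩
  f (g a) + sum (g ∘ punchIn a) + g a                     ≡⟨ +-assoc (f (g a)) _ (g a) ⟩
  f (g a) + (sum (g ∘ punchIn a) + g a)                   ≡⟨ cong (f (g a) +_) (+-comm _ (g a)) ⟩
  f (g a) + (g a + sum (g ∘ punchIn a))                   ≡⟨ cong (f (g a) +_) (sum-remove g) ⟨
  f (g a) + sum g                                         ∎
  where
  open ≡-Reasoning
  unchanged : ∀ r → updateAt g a f (punchIn a r) ≡ g (punchIn a r)
  unchanged r = updateAt-minimal (punchIn a r) a g (punchInᵢ≢i a r)

sum-concentrated : ∀ {m} (g : Fin m → ℕ) t → (∀ c → c ≢ t → g c ≡ 0) → sum g ≡ g t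
sum-concentrated {suc m} g t off = begin
  sum g                      ≡⟨ sum-remove g ⟩
  g t + sum (g ∘ punchIn t)  ≡⟨ cong (g t +_) (sum-cong-≗ (λ r → off _ (punchInᵢ≢i t r))) ⟩
  g t + sum {m} (const 0)    ≡⟨ cong (g t +_) (sum-replicate-zero m) ⟩
  g t + 0                    ≡⟨ +-identityʳ (g t) ⟩
  g t                        ∎
  where open ≡-Reasoning

_∈?_ : ∀ {m} (c : Fin m) (ps : List (Fin m)) → Dec (c ∈ ps)
c ∈? ps = any? (c ≟_) ps

indicator : ∀ {m} → List (Fin m) → (Fin m → ℕ) → Fin m → ℕ
indicator ps w c = if does (c ∈? ps) then w c else 0

indicator-∷ : ∀ {m} p ps (w : Fin m → ℕ) → indicator (p ∷ ps) w ≗ updateAt (indicator ps w) p (const (w p))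
indicator-∷ p ps w c with c ≟ p
... | yes refl = sym (updateAt-updates c (indicator ps w))
... | no c≢p   = sym (updateAt-minimal c p (indicator ps w) c≢p)

sum-indicator : ∀ {m} (w : Fin m → ℕ) {ps} → Unique ps → sum (indicator ps w) ≡ ListAction.sum (map w ps)
sum-indicator {m} w {[]}     []          = sum-replicate-zero m
sum-indicator     w {p ∷ ps} (p∉ps ∷ ps-unique) = +-cancelʳ-≡ _ _ _ (begin
  sum (indicator (p ∷ ps) w) + 0
    ≡⟨ cong₂ _+_ (sum-cong-≗ (indicator-∷ p ps w)) (sym p-off) ⟩
  sum (updateAt (indicator ps w) p (const (w p))) + indicator ps w p
    ≡⟨ sum-updateAt (indicator ps w) p (const (w p)) ⟩
  w p + sum (indicator ps w)           ≡⟨ cong (w p +_) (sum-indicator w ps-unique) ⟩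
  w p + ListAction.sum (map w ps)      ≡⟨ +-identityʳ _ ⟨
  w p + ListAction.sum (map w ps) + 0  ∎)
  where
  open ≡-Reasoning
  p-off : indicator ps w p ≡ 0
  p-off rewrite dec-false (p ∈? ps) (All¬⇒¬Any p∉ps) = refl

-- Paths of a single 1 and Kraft's inequality

transpose-matchˡ : ∀ {m} (a b : Fin m) → PC.transpose a b a ≡ b
transpose-matchˡ a b rewrite dec-true (a ≟ a) refl = refl

transpose-matchʳ : ∀ {m} (a b : Fin m) → PC.transpose a b b ≡ a
transpose-matchʳ a b with b ≟ a
... | yes b≡a = b≡a
... | no _ rewrite dec-true (b ≟ b) refl = refl

transpose-other : ∀ {m} {a b c : Fin m} → c ≢ a → c ≢ b → PC.transpose a b c ≡ c
transpose-other {a = a} {b} {c} c≢a c≢b rewrite dec-false (c ≟ a) c≢a | dec-false (c ≟ b) c≢b = refl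

transpose-involutive : ∀ {m} (a b c : Fin m) → PC.transpose a b (PC.transpose a b c) ≡ c
transpose-involutive a b c = by-cases (c ≟ a) (c ≟ b)
  where
  by-cases : Dec (c ≡ a) → Dec (c ≡ b) → PC.transpose a b (PC.transpose a b c) ≡ c
  by-cases (yes refl) _          = trans (cong (PC.transpose c b) (transpose-matchˡ c b)) (transpose-matchʳ c b)
  by-cases (no _)     (yes refl) = trans (cong (PC.transpose a c) (transpose-matchʳ a c)) (transpose-matchˡ a c)
  by-cases (no c≢a)   (no c≢b)   =
    trans (cong (PC.transpose a b) (transpose-other c≢a c≢b)) (transpose-other c≢a c≢b)

touches : ∀ {m} → Fin m → Fin m → Fin m → Bool
touches a b c = does (c ≟ a) ∨ does (c ≟ b)

touchesˡ : ∀ {m} (a b : Fin m) → touches a b a ≡ true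
touchesˡ a b rewrite dec-true (a ≟ a) refl = refl

touchesʳ : ∀ {m} (a b : Fin m) → touches a b b ≡ true
touchesʳ a b rewrite dec-true (b ≟ b) refl with does (b ≟ a)
... | true  = refl
... | false = refl

touches-other : ∀ {m} {a b c : Fin m} → c ≢ a → c ≢ b → touches a b c ≡ false
touches-other {a = a} {b} {c} c≢a c≢b rewrite dec-false (c ≟ a) c≢a | dec-false (c ≟ b) c≢b = refl

-- A single 1 entering N on channel c leaves on channel exit N c after meeting hits N c comparators.
exit : ∀ {m} → Network m → Fin m → Fin m
exit []              c = c
exit (exch a b ∷ N)  c = exit N (PC.transpose a b c)
exit (cmp a b _ ∷ N) c = if touches a b c then exit N b else exit N c

hits : ∀ {m} → Network m → Fin m → ℕ
hits []              c = 0
hits (exch a b ∷ N)  c = hits N (PC.transpose a b c)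
hits (cmp a b _ ∷ N) c = if touches a b c then suc (hits N b) else hits N c

module _ {m} {a b : Fin m} (a≢b : a ≢ b) (N : Network m) where

  exit-cmpˡ : exit (cmp a b a≢b ∷ N) a ≡ exit N b
  exit-cmpˡ rewrite touchesˡ a b = refl

  exit-cmpʳ : exit (cmp a b a≢b ∷ N) b ≡ exit N b
  exit-cmpʳ rewrite touchesʳ a b = refl

  exit-cmp-other : ∀ {c} → c ≢ a → c ≢ b → exit (cmp a b a≢b ∷ N) c ≡ exit N c
  exit-cmp-other c≢a c≢b rewrite touches-other c≢a c≢b = refl

  hits-cmpˡ : hits (cmp a b a≢b ∷ N) a ≡ suc (hits N b)
  hits-cmpˡ rewrite touchesˡ a b = refl

  hits-cmpʳ : hits (cmp a b a≢b ∷ N) b ≡ suc (hits N b)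
  hits-cmpʳ rewrite touchesʳ a b = refl

  hits-cmp-other : ∀ {c} → c ≢ a → c ≢ b → hits (cmp a b a≢b ∷ N) c ≡ hits N c
  hits-cmp-other c≢a c≢b rewrite touches-other c≢a c≢b = refl

merge : ∀ {m} → Fin m → Fin m → (Fin m → ℕ) → Fin m → ℕ
merge a b g = updateAt (updateAt g a (const 0)) b (const (2 * (g a ⊔ g b)))

module _ {m} {a b : Fin m} (a≢b : a ≢ b) (g : Fin m → ℕ) where

  merge-atʳ : merge a b g b ≡ 2 * (g a ⊔ g b)
  merge-atʳ = updateAt-updates b _

  merge-atˡ : merge a b g a ≡ 0
  merge-atˡ = trans (updateAt-minimal a b _ a≢b) (updateAt-updates a g)

  merge-other : ∀ {c} → c ≢ a → c ≢ b → merge a b g c ≡ g c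
  merge-other {c} c≢a c≢b = trans (updateAt-minimal c b _ c≢b) (updateAt-minimal c a g c≢a)

  sum-≤-merge : sum g ≤ sum (merge a b g)
  sum-≤-merge = +-cancelʳ-≤ (g b) _ _ (begin
    sum g + g b                   ≡⟨ cong (_+ g b) (sum-updateAt g a (const 0)) ⟨
    sum g₁ + g a + g b            ≡⟨ +-assoc (sum g₁) (g a) (g b) ⟩
    sum g₁ + (g a + g b)          ≤⟨ +-monoʳ-≤ (sum g₁) (+-mono-≤ (m≤m⊔n (g a) _) (m≤n⊔m _ (g b))) ⟩
    sum g₁ + (w + w)              ≡⟨ cong (λ v → sum g₁ + (w + v)) (+-identityʳ w) ⟨
    sum g₁ + 2 * w                ≡⟨ +-comm (sum g₁) (2 * w) ⟩
    2 * w + sum g₁                ≡⟨ sum-updateAt g₁ b (const (2 * w)) ⟨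
    sum (merge a b g) + g₁ b      ≡⟨ cong (sum (merge a b g) +_) (updateAt-minimal b a g (a≢b ∘ sym)) ⟩
    sum (merge a b g) + g b       ∎)
    where
    open ≤-Reasoning
    g₁ = updateAt g a (const 0)
    w = g a ⊔ g b

module _ {m} {a b : Fin m} (a≢b : a ≢ b) {N : Network m} {g : Fin m → ℕ} where

  merge-off : ∀ {t} → (∀ c → exit (cmp a b a≢b ∷ N) c ≢ t → g c ≡ 0) →
              ∀ c → exit N c ≢ t → merge a b g c ≡ 0
  merge-off {t} off c exit≢t = by-cases (c ≟ b) (c ≟ a)
    where
    by-cases : Dec (c ≡ b) → Dec (c ≡ a) → merge a b g c ≡ 0
    by-cases (yes refl) _ = trans (merge-atʳ a≢b g) (cong₂ (λ x y → 2 * (x ⊔ y))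
      (off a (exit≢t ∘ trans (sym (exit-cmpˡ a≢b N))))
      (off b (exit≢t ∘ trans (sym (exit-cmpʳ a≢b N)))))
    by-cases (no _)     (yes refl) = merge-atˡ a≢b g
    by-cases (no c≢b)   (no c≢a)   =
      trans (merge-other a≢b g c≢a c≢b) (off c (exit≢t ∘ trans (sym (exit-cmp-other a≢b N c≢a c≢b))))

  merge-bound : ∀ {h} → (∀ c → g c * 2 ^ hits (cmp a b a≢b ∷ N) c ≤ 2 ^ h) →
                ∀ c → merge a b g c * 2 ^ hits N c ≤ 2 ^ h
  merge-bound {h} bound c = by-cases (c ≟ b) (c ≟ a)
    where
    by-cases : Dec (c ≡ b) → Dec (c ≡ a) → merge a b g c * 2 ^ hits N c ≤ 2 ^ h
    by-cases (yes refl) _ = begin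
      merge a b g c * 2 ^ hits N c                  ≡⟨ cong (_* 2 ^ hits N c) (merge-atʳ a≢b g) ⟩
      2 * (g a ⊔ g c) * 2 ^ hits N c                ≡⟨ cong (_* 2 ^ hits N c) (*-comm 2 (g a ⊔ g c)) ⟩
      (g a ⊔ g c) * 2 * 2 ^ hits N c                ≡⟨ *-assoc (g a ⊔ g c) 2 (2 ^ hits N c) ⟩
      (g a ⊔ g c) * 2 ^ suc (hits N c)              ≡⟨ *-distribʳ-⊔ (2 ^ suc (hits N c)) (g a) (g c) ⟩
      g a * 2 ^ suc (hits N c) ⊔ g c * 2 ^ suc (hits N c)
        ≤⟨ ⊔-lub (subst (λ k → g a * 2 ^ k ≤ 2 ^ h) (hits-cmpˡ a≢b N) (bound a))
                 (subst (λ k → g c * 2 ^ k ≤ 2 ^ h) (hits-cmpʳ a≢b N) (bound c)) ⟩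
      2 ^ h                                         ∎
      where open ≤-Reasoning
    by-cases (no _)     (yes refl) rewrite merge-atˡ a≢b g = z≤n
    by-cases (no c≢b)   (no c≢a)   rewrite merge-other a≢b g c≢a c≢b =
      subst (λ k → g c * 2 ^ k ≤ 2 ^ h) (hits-cmp-other a≢b N c≢a c≢b) (bound c)

-- Kraft's inequality Σ_{exit N c = t} 2 ^ (- hits N c) ≤ 1, with the terms weighted by g and scaled by 2 ^ h.
kraft : ∀ {m} (N : Network m) t h (g : Fin m → ℕ) →
        (∀ c → exit N c ≢ t → g c ≡ 0) → (∀ c → g c * 2 ^ hits N c ≤ 2 ^ h) → sum g ≤ 2 ^ h
kraft [] t h g off bound = begin
  sum g        ≡⟨ sum-concentrated g t off ⟩
  g t          ≡⟨ *-identityʳ (g t) ⟨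
  g t * 2 ^ 0  ≤⟨ bound t ⟩
  2 ^ h        ∎
  where open ≤-Reasoning
kraft (exch a b ∷ N) t h g off bound =
  subst (_≤ 2 ^ h) (sym (sum-permute g (transpose a b))) (kraft N t h (g ∘ τ) off′ bound′)
  where
  τ = PC.transpose a b
  off′ : ∀ c → exit N c ≢ t → g (τ c) ≡ 0
  off′ c exit≢t = off (τ c) (exit≢t ∘ trans (cong (exit N) (sym (transpose-involutive a b c))))
  bound′ : ∀ c → g (τ c) * 2 ^ hits N c ≤ 2 ^ h
  bound′ c = subst (λ d → g (τ c) * 2 ^ hits N d ≤ 2 ^ h) (transpose-involutive a b c) (bound (τ c))
kraft (cmp a b a≢b ∷ N) t h g off bound =
  ≤-trans (sum-≤-merge a≢b g)
    (kraft N t h (merge a b g) (merge-off a≢b {N} off) (merge-bound a≢b {N} {h = h} bound))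

-- Pruning the path of a single 1

module _ {m} {a b : Fin m} (x : B^ m) where

  lookup-exch : ∀ p → lookup (applyOp (exch a b) x) p ≡ lookup x (PC.transpose a b p)
  lookup-exch p = by-cases (p ≟ b) (p ≟ a)
    where
    by-cases : Dec (p ≡ b) → Dec (p ≡ a) → lookup (applyOp (exch a b) x) p ≡ lookup x (PC.transpose a b p)
    by-cases (yes refl) _ = trans (lookup∘update p (x [ a ]≔ lookup x p) _)
      (cong (lookup x) (sym (transpose-matchʳ a p)))
    by-cases (no p≢b) (yes refl) = trans (lookup∘update′ p≢b (x [ p ]≔ lookup x b) _)
      (trans (lookup∘update p x _) (cong (lookup x) (sym (transpose-matchˡ p b))))
    by-cases (no p≢b) (no p≢a) = trans (lookup∘update′ p≢b (x [ a ]≔ lookup x b) _)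
      (trans (lookup∘update′ p≢a x _) (cong (lookup x) (sym (transpose-other p≢a p≢b))))

  module _ (a≢b : a ≢ b) where

    lookup-cmpˡ : lookup (applyOp (cmp a b a≢b) x) a ≡ (lookup x a ∧ lookup x b)
    lookup-cmpˡ = trans (lookup∘update′ a≢b (x [ a ]≔ (lookup x a ∧ lookup x b)) _) (lookup∘update a x _)

    lookup-cmpʳ : lookup (applyOp (cmp a b a≢b) x) b ≡ (lookup x a ∨ lookup x b)
    lookup-cmpʳ = lookup∘update b (x [ a ]≔ (lookup x a ∧ lookup x b)) _

    lookup-cmp-other : ∀ {p} → p ≢ a → p ≢ b → lookup (applyOp (cmp a b a≢b) x) p ≡ lookup x p
    lookup-cmp-other p≢a p≢b =
      trans (lookup∘update′ p≢b (x [ a ]≔ (lookup x a ∧ lookup x b)) _) (lookup∘update′ p≢a x _)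

    cmp-with-1ˡ : lookup x a ≡ true → ∀ p → lookup (applyOp (cmp a b a≢b) x) p ≡ lookup x (PC.transpose a b p)
    cmp-with-1ˡ xa≡1 p = by-cases (p ≟ b) (p ≟ a)
      where
      by-cases : Dec (p ≡ b) → Dec (p ≡ a) → lookup (applyOp (cmp a b a≢b) x) p ≡ lookup x (PC.transpose a b p)
      by-cases (yes refl) _ = begin
        lookup (applyOp (cmp a p a≢b) x) p   ≡⟨ lookup-cmpʳ ⟩
        lookup x a ∨ lookup x p              ≡⟨ cong (_∨ lookup x p) xa≡1 ⟩
        true                                 ≡⟨ xa≡1 ⟨
        lookup x a                           ≡⟨ cong (lookup x) (transpose-matchʳ a p) ⟨
        lookup x (PC.transpose a p p)        ∎
        where open ≡-Reasoning
      by-cases (no _) (yes refl) = begin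
        lookup (applyOp (cmp p b a≢b) x) p   ≡⟨ lookup-cmpˡ ⟩
        lookup x p ∧ lookup x b              ≡⟨ cong (_∧ lookup x b) xa≡1 ⟩
        lookup x b                           ≡⟨ cong (lookup x) (transpose-matchˡ p b) ⟨
        lookup x (PC.transpose p b p)        ∎
        where open ≡-Reasoning
      by-cases (no p≢b) (no p≢a) =
        trans (lookup-cmp-other p≢a p≢b) (cong (lookup x) (sym (transpose-other p≢a p≢b)))

    cmp-with-1ʳ : lookup x b ≡ true → ∀ p → lookup (applyOp (cmp a b a≢b) x) p ≡ lookup x p
    cmp-with-1ʳ xb≡1 p = by-cases (p ≟ b) (p ≟ a)
      where
      by-cases : Dec (p ≡ b) → Dec (p ≡ a) → lookup (applyOp (cmp a b a≢b) x) p ≡ lookup x p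
      by-cases (yes refl) _ = trans lookup-cmpʳ (trans (cong (lookup x a ∨_) xb≡1) (trans (∨-zeroʳ _) (sym xb≡1)))
      by-cases (no _) (yes refl) = trans lookup-cmpˡ (trans (cong (lookup x p ∧_) xb≡1) (∧-identityʳ _))
      by-cases (no p≢b) (no p≢a) = lookup-cmp-other p≢a p≢b

cmp-reindex : ∀ {m n} (f : Fin n → Fin m) → (∀ {r s} → f r ≡ f s → r ≡ s) →
              ∀ {a b a′ b′} (a≢b : a ≢ b) (a′≢b′ : a′ ≢ b′) → f a′ ≡ a → f b′ ≡ b →
              ∀ {x y} → (∀ r → lookup y r ≡ lookup x (f r)) →
              ∀ r → lookup (applyOp (cmp a′ b′ a′≢b′) y) r ≡ lookup (applyOp (cmp a b a≢b) x) (f r)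
cmp-reindex f f-injective {a′ = a′} {b′} a≢b a′≢b′ refl refl {x} {y} y≡x∘f r =
  by-cases (r ≟ b′) (r ≟ a′)
  where
  by-cases : Dec (r ≡ b′) → Dec (r ≡ a′) →
             lookup (applyOp (cmp a′ b′ a′≢b′) y) r ≡ lookup (applyOp (cmp (f a′) (f b′) a≢b) x) (f r)
  by-cases (yes refl) _ = trans (lookup-cmpʳ y a′≢b′)
    (trans (cong₂ _∨_ (y≡x∘f a′) (y≡x∘f r)) (sym (lookup-cmpʳ x a≢b)))
  by-cases (no _) (yes refl) = trans (lookup-cmpˡ y a′≢b′)
    (trans (cong₂ _∧_ (y≡x∘f r) (y≡x∘f b′)) (sym (lookup-cmpˡ x a≢b)))
  by-cases (no r≢b′) (no r≢a′) = trans (lookup-cmp-other y a′≢b′ r≢a′ r≢b′)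
    (trans (y≡x∘f r) (sym (lookup-cmp-other x a≢b (r≢a′ ∘ f-injective) (r≢b′ ∘ f-injective))))

liftOp : ∀ {n} → Op n → Op (suc n)
liftOp (cmp a b a≢b) = cmp (suc a) (suc b) (a≢b ∘ suc-injective)
liftOp (exch a b)    = exch (suc a) (suc b)

apply-liftOp : ∀ {n} (E : Network n) v y → apply (map liftOp E) (v ∷ y) ≡ v ∷ apply E y
apply-liftOp []                v y = refl
apply-liftOp (cmp a b a≢b ∷ E) v y = apply-liftOp E v _
apply-liftOp (exch a b ∷ E)    v y = apply-liftOp E v _

size-liftOp : ∀ {n} (E : Network n) → size (map liftOp E) ≡ size E
size-liftOp []                = refl
size-liftOp (cmp a b a≢b ∷ E) = cong suc (size-liftOp E)
size-liftOp (exch a b ∷ E)    = size-liftOp E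

permutationNetwork : ∀ {n} → Permutation′ n → Network n
permutationNetwork {zero}  ρ = []
permutationNetwork {suc n} ρ =
  exch zero (ρ ⟨$⟩ʳ zero) ∷ map liftOp (permutationNetwork (remove zero (ρ ∘ₚ transpose zero (ρ ⟨$⟩ʳ zero))))

size-permutationNetwork : ∀ {n} (ρ : Permutation′ n) → size (permutationNetwork ρ) ≡ 0
size-permutationNetwork {zero}  ρ = refl
size-permutationNetwork {suc n} ρ = trans (size-liftOp (permutationNetwork σ)) (size-permutationNetwork σ)
  where σ = remove zero (ρ ∘ₚ transpose zero (ρ ⟨$⟩ʳ zero))

lookup-permutationNetwork : ∀ {n} (ρ : Permutation′ n) y r →
                            lookup (apply (permutationNetwork ρ) y) r ≡ lookup y (ρ ⟨$⟩ʳ r)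
lookup-permutationNetwork {suc n} ρ y r = begin
  lookup (apply (map liftOp E) y′) r       ≡⟨ lookup-lifted y′ r ⟩
  lookup y′ (lift₀ σ ⟨$⟩ʳ r)                ≡⟨ cong (lookup y′) (lift₀-remove ρ′ (transpose-matchʳ zero s) r) ⟩
  lookup y′ (ρ′ ⟨$⟩ʳ r)                     ≡⟨ lookup-exch y (ρ′ ⟨$⟩ʳ r) ⟩
  lookup y (PC.transpose zero s (ρ′ ⟨$⟩ʳ r)) ≡⟨ cong (lookup y) (transpose-involutive zero s (ρ ⟨$⟩ʳ r)) ⟩
  lookup y (ρ ⟨$⟩ʳ r)                       ∎
  where
  open ≡-Reasoning
  s = ρ ⟨$⟩ʳ zero
  y′ = applyOp (exch zero s) y
  ρ′ = ρ ∘ₚ transpose zero s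
  σ = remove zero ρ′
  E = permutationNetwork σ
  lookup-lifted : ∀ z r → lookup (apply (map liftOp E) z) r ≡ lookup z (lift₀ σ ⟨$⟩ʳ r)
  lookup-lifted (v ∷ z) zero    rewrite apply-liftOp E v z = refl
  lookup-lifted (v ∷ z) (suc r) rewrite apply-liftOp E v z = lookup-permutationNetwork σ z r

record Pruned {n} (τ : Permutation′ (suc n)) (x : B^ (suc n)) (y : B^ n) : Set where
  constructor pruned
  field
    pruned-1 : lookup x (τ ⟨$⟩ʳ zero) ≡ true
    others   : ∀ r → lookup y r ≡ lookup x (τ ⟨$⟩ʳ suc r)

-- focus i sends 0 to i and suc r to punchIn i r.
focus : ∀ {n} → Fin (suc n) → Permutation′ (suc n)
focus i = Perm.insert zero i Perm.id

Pruned-transpose : ∀ {n} {τ : Permutation′ (suc n)} {a b x x′ y} →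
                   (∀ p → lookup x′ p ≡ lookup x (PC.transpose a b p)) →
                   Pruned τ x y → Pruned (τ ∘ₚ transpose a b) x′ y
Pruned-transpose {τ = τ} {a} {b} {x} x′≡x∘τ (pruned x-1 y≡x∘τ) = pruned
    (trans (x′≡x∘τ _) (trans (cong (lookup x) (transpose-involutive a b _)) x-1))
    (λ r → trans (y≡x∘τ r) (sym (trans (x′≡x∘τ _) (cong (lookup x) (transpose-involutive a b _)))))

residual : ∀ {n} (τ : Permutation′ (suc n)) {a} → τ ⟨$⟩ʳ zero ≢ a → Fin n
residual τ τ0≢a = punchOut {i = zero} (λ 0≡τ⁻¹a → τ0≢a (trans (cong (τ ⟨$⟩ʳ_) 0≡τ⁻¹a) (inverseʳ τ)))

residual-spec : ∀ {n} (τ : Permutation′ (suc n)) {a} (τ0≢a : τ ⟨$⟩ʳ zero ≢ a) →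
                τ ⟨$⟩ʳ suc (residual τ τ0≢a) ≡ a
residual-spec τ {a} τ0≢a =
  trans (cong (τ ⟨$⟩ʳ_) (punchIn-punchOut {i = zero} {j = τ ⟨$⟩ˡ a} _)) (inverseʳ τ)

residual-≢ : ∀ {n} (τ : Permutation′ (suc n)) {a b}
             (τ0≢a : τ ⟨$⟩ʳ zero ≢ a) (τ0≢b : τ ⟨$⟩ʳ zero ≢ b) →
             a ≢ b → residual τ τ0≢a ≢ residual τ τ0≢b
residual-≢ τ τ0≢a τ0≢b a≢b eq =
  a≢b (trans (sym (residual-spec τ τ0≢a)) (trans (cong (λ r → τ ⟨$⟩ʳ suc r) eq) (residual-spec τ τ0≢b)))

-- The pruned 1 turns a comparator it meets into an exchange (1 on the lower channel) or into the identity
-- (1 on the upper channel); at the end, exchanges restore the order of the remaining wires.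
prune : ∀ {n} → Network (suc n) → Permutation′ (suc n) → Network n
prune []                τ = permutationNetwork (flip (remove zero τ))
prune (exch a b ∷ N)    τ = prune N (τ ∘ₚ transpose a b)
prune (cmp a b a≢b ∷ N) τ with τ ⟨$⟩ʳ zero ≟ a | τ ⟨$⟩ʳ zero ≟ b
... | yes _    | _        = prune N (τ ∘ₚ transpose a b)
... | no _     | yes _    = prune N τ
... | no τ0≢a  | no τ0≢b  =
  cmp (residual τ τ0≢a) (residual τ τ0≢b) (residual-≢ τ τ0≢a τ0≢b a≢b) ∷ prune N τ

prune-size : ∀ {n} (N : Network (suc n)) τ → size (prune N τ) + hits N (τ ⟨$⟩ʳ zero) ≡ size N
prune-size []                τ = cong (_+ 0) (size-permutationNetwork (flip (remove zero τ)))
prune-size (exch a b ∷ N)    τ = prune-size N (τ ∘ₚ transpose a b)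
prune-size (cmp a b a≢b ∷ N) τ with τ ⟨$⟩ʳ zero ≟ a | τ ⟨$⟩ʳ zero ≟ b
... | yes refl | _ = begin
  size P + suc (hits N b)                  ≡⟨ +-suc (size P) _ ⟩
  suc (size P + hits N b)                  ≡⟨ cong (λ c → suc (size P + hits N c)) (transpose-matchˡ a b) ⟨
  suc (size P + hits N (PC.transpose a b a)) ≡⟨ cong suc (prune-size N (τ ∘ₚ transpose a b)) ⟩
  suc (size N)                             ∎
  where
  open ≡-Reasoning
  P = prune N (τ ∘ₚ transpose a b)
... | no _ | yes refl = begin
  size P + suc (hits N b)                  ≡⟨ +-suc (size P) _ ⟩
  suc (size P + hits N b)                  ≡⟨ cong suc (prune-size N τ) ⟩
  suc (size N)                             ∎
  where
  open ≡-Reasoning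
  P = prune N τ
... | no τ0≢a | no τ0≢b = cong suc (prune-size N τ)

Pruned-resp-≗ : ∀ {n} {τ : Permutation′ (suc n)} {x x′ y} → (∀ p → lookup x′ p ≡ lookup x p) →
                Pruned τ x y → Pruned τ x′ y
Pruned-resp-≗ x′≡x (pruned x-1 y≡x∘τ) =
  pruned (trans (x′≡x _) x-1) (λ r → trans (y≡x∘τ r) (sym (x′≡x _)))

prune-correct : ∀ {n} (N : Network (suc n)) τ {x y} → Pruned τ x y →
                Pruned (focus (exit N (τ ⟨$⟩ʳ zero))) (apply N x) (apply (prune N τ) y)
prune-correct [] τ {x} {y} (pruned x-1 y≡x∘τ) = pruned x-1 λ r → begin
  lookup (apply (permutationNetwork (flip σ)) y) r  ≡⟨ lookup-permutationNetwork (flip σ) y r ⟩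
  lookup y (σ ⟨$⟩ˡ r)                              ≡⟨ y≡x∘τ (σ ⟨$⟩ˡ r) ⟩
  lookup x (τ ⟨$⟩ʳ suc (σ ⟨$⟩ˡ r))
    ≡⟨ cong (lookup x) (punchIn-permute τ zero (σ ⟨$⟩ˡ r)) ⟩
  lookup x (punchIn (τ ⟨$⟩ʳ zero) (σ ⟨$⟩ʳ (σ ⟨$⟩ˡ r)))
    ≡⟨ cong (lookup x ∘ punchIn (τ ⟨$⟩ʳ zero)) (inverseʳ σ) ⟩
  lookup x (punchIn (τ ⟨$⟩ʳ zero) r)               ∎
  where
  open ≡-Reasoning
  σ = remove zero τ
prune-correct (exch a b ∷ N) τ {x} x⊒y =
  prune-correct N (τ ∘ₚ transpose a b) (Pruned-transpose (lookup-exch x) x⊒y)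
prune-correct (cmp a b a≢b ∷ N) τ {x} {y} x⊒y@(pruned x-1 y≡x∘τ)
  with τ ⟨$⟩ʳ zero ≟ a | τ ⟨$⟩ʳ zero ≟ b
... | yes refl | _ = subst (λ p → Pruned (focus p) (apply N x′) (apply (prune N τ′) y))
  (cong (exit N) (transpose-matchˡ a b)) (prune-correct N τ′ (Pruned-transpose (cmp-with-1ˡ x a≢b x-1) x⊒y))
  where
  x′ = applyOp (cmp a b a≢b) x
  τ′ = τ ∘ₚ transpose a b
... | no _ | yes refl = prune-correct N τ (Pruned-resp-≗ (cmp-with-1ʳ x a≢b x-1) x⊒y)
... | no τ0≢a | no τ0≢b = prune-correct N τ (pruned
  (trans (lookup-cmp-other x a≢b τ0≢a τ0≢b) x-1)
  (cmp-reindex (λ r → τ ⟨$⟩ʳ suc r) τ∘suc-injective a≢b (residual-≢ τ τ0≢a τ0≢b a≢b)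
      (residual-spec τ τ0≢a) (residual-spec τ τ0≢b) {x} {y} y≡x∘τ))
  where
  τ∘suc-injective : ∀ {r s} → τ ⟨$⟩ʳ suc r ≡ τ ⟨$⟩ʳ suc s → r ≡ s
  τ∘suc-injective e = suc-injective (trans (sym (inverseˡ τ)) (trans (cong (τ ⟨$⟩ˡ_) e) (inverseˡ τ)))

apply-preserves-false : ∀ {m} (E : Network m) {y} →
                        (∀ r → lookup y r ≡ false) → ∀ r → lookup (apply E y) r ≡ false
apply-preserves-false []               y≡0 = y≡0
apply-preserves-false (exch a b ∷ E)   {y} y≡0 = apply-preserves-false E (λ r → trans (lookup-exch y r) (y≡0 _))
apply-preserves-false (cmp a b a≢b ∷ E) {y} y≡0 = apply-preserves-false E (λ r → by-cases r (r ≟ b) (r ≟ a))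
  where
  by-cases : ∀ r → Dec (r ≡ b) → Dec (r ≡ a) → lookup (applyOp (cmp a b a≢b) y) r ≡ false
  by-cases r (yes refl) _        = trans (lookup-cmpʳ y a≢b) (cong₂ _∨_ (y≡0 a) (y≡0 r))
  by-cases r (no _)     (yes refl) = trans (lookup-cmpˡ y a≢b) (cong₂ _∧_ (y≡0 r) (y≡0 b))
  by-cases r (no r≢b)   (no r≢a)   = trans (lookup-cmp-other y a≢b r≢a r≢b) (y≡0 r)

lookup-removeAt : ∀ {n} (x : B^ (suc n)) i r → lookup (removeAt x i) r ≡ lookup x (punchIn i r)
lookup-removeAt x i r = trans (cong (lookup (removeAt x i)) (sym (punchOut-punchIn i))) (removeAt-punchOut x _)

Pruned-focus : ∀ {n} {x : B^ (suc n)} {i} → lookup x i ≡ true → Pruned (focus i) x (removeAt x i)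
Pruned-focus {x = x} {i} x-1 = pruned x-1 (lookup-removeAt x i)

lookup-oneHot : ∀ {n} (i j : Fin n) → lookup (oneHot i) j ≡ does (j ≟ i)
lookup-oneHot i = lookup∘tabulate (λ j → does (j ≟ i))

module _ {n} {X : BSet (suc n)} (N : Network (suc n)) (N-sorts : Sorts N X) where

  -- The output on the one-hot input e_i is sorted and has its only 1 on channel exit N i.
  exit-prunable : ∀ {i} → Prunable X i → exit N i ≡ fromℕ n
  exit-prunable {i} X-eᵢ = by-cases (exit N i ≟ fromℕ n)
    where
    x = oneHot i
    e = exit N i
    y = removeAt x i
    P = prune N (focus i)
    outcome = prune-correct N (focus i) (Pruned-focus {x = x} (trans (lookup-oneHot i i) (dec-true (i ≟ i) refl)))
    last≡1 : lookup (apply N x) (fromℕ n) ≡ true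
    last≡1 = N-sorts x X-eᵢ e (fromℕ n) (≤fromℕ e) (Pruned.pruned-1 outcome)
    y≡0 : ∀ r → lookup y r ≡ false
    y≡0 r = trans (lookup-removeAt x i r)
      (trans (lookup-oneHot i (punchIn i r)) (dec-false (punchIn i r ≟ i) (punchInᵢ≢i i r)))
    last≡0 : exit N i ≢ fromℕ n → lookup (apply N x) (fromℕ n) ≡ false
    last≡0 exit≢last = begin
      lookup (apply N x) (fromℕ n)                          ≡⟨ cong (lookup (apply N x)) (punchIn-punchOut exit≢last) ⟨
      lookup (apply N x) (punchIn e (punchOut exit≢last))   ≡⟨ Pruned.others outcome _ ⟨
      lookup (apply P y) (punchOut exit≢last)               ≡⟨ apply-preserves-false P y≡0 _ ⟩
      false                                                 ∎
      where open ≡-Reasoning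
    by-cases : Dec (exit N i ≡ fromℕ n) → exit N i ≡ fromℕ n
    by-cases (yes exit≡last) = exit≡last
    by-cases (no exit≢last)  with () ← trans (sym last≡1) (last≡0 exit≢last)

  prune-sorts : ∀ i → Sorts (prune N (focus i)) (del X i)
  prune-sorts i y (x , Xx , x-1 , refl) r s r≤s y-r≡1 =
    trans (out s) (N-sorts x Xx _ _ (punchIn-mono-≤ (exit N i) r s r≤s) (trans (sym (out r)) y-r≡1))
    where out = Pruned.others (prune-correct N (focus i) (Pruned-focus x-1))

  minSize+hits≤size : ∀ {i s} → IsMinSize (interior (del X i)) s → s + hits N i ≤ size N
  minSize+hits≤size {i} {s} (_ , minimal) = begin
    s + hits N i       ≤⟨ +-monoˡ-≤ (hits N i) (minimal P (λ y → prune-sorts i y ∘ interior-⊆)) ⟩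
    size P + hits N i  ≡⟨ prune-size N (focus i) ⟩
    size N             ∎
    where
    open ≤-Reasoning
    P = prune N (focus i)
    interior-⊆ : ∀ {Y : BSet n} {y} → interior Y y → Y y
    interior-⊆ (_ , T⊆Y , y∈T) = T⊆Y _ y∈T

-- Threshold sets

n≤toℕ⇒≡fromℕ : ∀ {n} (j : Fin (suc n)) → n ≤ toℕ j → j ≡ fromℕ n
n≤toℕ⇒≡fromℕ {n} j n≤j =
  toℕ-injective (trans (≤-antisym (s≤s⁻¹ (toℕ<n j)) n≤j) (sym (toℕ-fromℕ n)))

-- The threshold k = n + 1 of the permutation π picks out its largest entry.
threshold-oneHot : ∀ {n} (π : Permutation′ (suc n)) → InT π (oneHot (π ⟨$⟩ˡ fromℕ n))
threshold-oneHot {n} π = suc n , s≤s z≤n , n≤1+n (suc n) , tabulate-cong at-top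
  where
  top = π ⟨$⟩ˡ fromℕ n
  is-top : ∀ {j} → suc n ≤ suc (toℕ (π ⟨$⟩ʳ j)) → j ≡ top
  is-top {j} le = trans (sym (inverseˡ π)) (cong (π ⟨$⟩ˡ_) (n≤toℕ⇒≡fromℕ _ (s≤s⁻¹ le)))
  top-is : ∀ {j} → j ≡ top → suc n ≤ suc (toℕ (π ⟨$⟩ʳ j))
  top-is refl = s≤s (≤-reflexive (sym (trans (cong toℕ (inverseʳ π)) (toℕ-fromℕ n))))
  at-top : ∀ j → does (j ≟ top) ≡ (suc n ≤ᵇ suc (toℕ (π ⟨$⟩ʳ j)))
  at-top j = det (proof (j ≟ top)) (fromEquivalence (is-top ∘ ≤ᵇ⇒≤ _ _) (≤⇒≤ᵇ ∘ top-is))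

prunable-exists : ∀ {n} {X : BSet (suc n)} → (∃ λ x → X x) → WellBehaved X → ∃ λ i → Prunable X i
prunable-exists {n} (x , Xx) (πs , X⇔) with find (Equivalence.to (X⇔ x) Xx)
... | π , π∈πs , _ = π ⟨$⟩ˡ fromℕ n , Equivalence.from (X⇔ _) (lose π∈πs (threshold-oneHot π))

mainTheorem4 : ∀ (n : ℕ) (X : BSet (suc n)) → (∃ λ x → X x) → WellBehaved X →
    (∃ λ i → Prunable X i) ×
    (∀ (ps : List (Fin (suc n))) → Unique ps → (∀ i → i ∈ ps ⇔ Prunable X i) →
     ∀ (sv : Fin (suc n) → ℕ) → (∀ i → Prunable X i → IsMinSize (interior (del X i)) (sv i)) →
     ∀ (N : Network (suc n)) → Sorts N X → H1+max (map sv ps) ≤ size N)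
mainTheorem4 n X nonempty well-behaved = prunable-exists nonempty well-behaved , lower-bound
  where
  lower-bound : ∀ ps → Unique ps → (∀ i → i ∈ ps ⇔ Prunable X i) →
                ∀ sv → (∀ i → Prunable X i → IsMinSize (interior (del X i)) (sv i)) →
                ∀ N → Sorts N X → H1+max (map sv ps) ≤ size N
  lower-bound ps ps-unique ps⇔p sv sv-min N N-sorts = H1+max-≤ (map sv ps) (size N) (begin
    sum2^ (map sv ps)                         ≡⟨ cong ListAction.sum (map-∘ ps) ⟨
    ListAction.sum (map w ps)                 ≡⟨ sum-indicator w ps-unique ⟨
    sum (indicator ps w)                      ≤⟨ kraft N (fromℕ n) (size N) (indicator ps w) off bound ⟩
    2 ^ size N                                ∎)
    where
    open ≤-Reasoning
    w : Fin (suc n) → ℕ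
    w i = 2 ^ sv i
    off : ∀ c → exit N c ≢ fromℕ n → indicator ps w c ≡ 0
    off c exit≢last with c ∈? ps
    ... | yes c∈ps = ⊥-elim (exit≢last (exit-prunable N N-sorts (Equivalence.to (ps⇔p c) c∈ps)))
    ... | no _     = refl
    bound : ∀ c → indicator ps w c * 2 ^ hits N c ≤ 2 ^ size N
    bound c with c ∈? ps
    ... | yes c∈ps = subst (_≤ 2 ^ size N) (^-distribˡ-+-* 2 (sv c) (hits N c))
                       (^-monoʳ-≤ 2 (minSize+hits≤size N N-sorts (sv-min c (Equivalence.to (ps⇔p c) c∈ps))))
    ... | no _     = z≤n
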